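{- Let $H$ be a cyclic group of order $p_1p_2p_3$, where $p_1,p_2,p_3$ are distinct primes. Then $OD(H)$ is isomorphic to $$\Big(\big((G_1\diamond G_{12})\cup(G_{12}\diamond G_2)\cup(G_2\diamond G_{23})\cup(G_{23}\diamond G_3)\cup(G_3\diamond G_{13})\cup(G_{13}\diamond G_1)\big)\diamond G_{123}\Big)\diamond K_1,$$ where $G_i\cong(p_i-1)K_1$ for $1\leq i\leq 3$, $G_{12}\cong(p_1-1)(p_2-1)K_1$, $G_{23}\cong(p_2-1)(p_3-1)K_1$, $G_{13}\cong(p_1-1)(p_3-1)K_1$ and $G_{123}\cong(p_1-1)(p_2-1)(p_3-1)K_1$.
   Context: For a finite group $G$, the order divisor graph $OD(G)$ is the simple undirected graph with vertex set $G$ in which two distinct vertices $a,b$ are adjacent if and only if $o(a)\neq o(b)$ and either $o(a)\mid o(b)$ or $o(b)\mid o(a)$. $mK_1$ denotes the edgeless graph on $m$ vertices. For graphs $A,B$ on disjoint vertex sets, $A\diamond B$ (the join) is the graph on $V(A)\cup V(B)$ with all edges of $A$ and $B$ plus every edge joining a vertex of $A$ to a vertex of $B$. In the displayed expression, $G_1,G_2,G_3,G_{12},G_{23},G_{13},G_{123}$ are seven fixed graphs on pairwise disjoint vertex sets and $K_1$ is one further vertex; $\cup$ denotes the union of graphs (union of vertex sets and of edge sets, the same named graph contributing the same vertices each time it occurs). Hence the graph consists of the seven independent sets, with complete bipartite connections between $G_1$–$G_{12}$, $G_{12}$–$G_2$, $G_2$–$G_{23}$, $G_{23}$–$G_3$,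 $G_3$–$G_{13}$, $G_{13}$–$G_1$, between $G_{123}$ and each of the other six, and a vertex ($K_1$) adjacent to all other vertices. -}

module Defs where

open import Data.Nat using (ℕ; zero; suc; _+_; _*_; _∸_; _≤_; _<_)
open import Data.Nat.Divisibility using (_∣_)
open import Data.Fin using (Fin; toℕ)
open import Data.Product using (Σ; _×_; _,_; ∃; ∃-syntax)
open import Data.Sum using (_⊎_)
open import Data.Unit using (⊤)
open import Data.Empty using (⊥)
open import Relation.Binary.PropositionalEquality using (_≡_; _≢_)

-- The cyclic group of order n, modelled as ℤ/nℤ with carrier Fin n
-- (element a ∈ Fin n stands for the residue class of toℕ a).
-- In ℤ/nℤ the k-th multiple k·a is the class of k * toℕ a, which is the
-- identity iff n ∣ k * toℕ a.

MultIsZero : (n : ℕ) → ℕ → Fin n → Set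
MultIsZero n k a = n ∣ k * toℕ a

IsOrder : (n : ℕ) → Fin n → ℕ → Set
IsOrder n a k =
  (1 ≤ k) × MultIsZero n k a × (∀ j → 1 ≤ j → j < k → ¬Z j)
  where
  ¬Z : ℕ → Set
  ¬Z j = MultIsZero n j a → ⊥

ODAdj : (n : ℕ) → Fin n → Fin n → Set
ODAdj n a b =
  (a ≢ b) × ∃[ k ] ∃[ l ] (IsOrder n a k × IsOrder n b l × (k ≢ l) × (k ∣ l ⊎ l ∣ k))

-- The target graph: seven independent sets G1,G2,G3,G12,G23,G13,G123
-- and one extra vertex K (= K₁).

data Block : Set where
  B1 B2 B3 B12 B23 B13 B123 K : Block

blockSize : ℕ → ℕ → ℕ → Block → ℕ
blockSize p₁ p₂ p₃ B1   = p₁ ∸ 1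
blockSize p₁ p₂ p₃ B2   = p₂ ∸ 1
blockSize p₁ p₂ p₃ B3   = p₃ ∸ 1
blockSize p₁ p₂ p₃ B12  = (p₁ ∸ 1) * (p₂ ∸ 1)
blockSize p₁ p₂ p₃ B23  = (p₂ ∸ 1) * (p₃ ∸ 1)
blockSize p₁ p₂ p₃ B13  = (p₁ ∸ 1) * (p₃ ∸ 1)
blockSize p₁ p₂ p₃ B123 = (p₁ ∸ 1) * (p₂ ∸ 1) * (p₃ ∸ 1)
blockSize p₁ p₂ p₃ K    = 1

BlockAdj : Block → Block → Set
-- the hexagon (G1⋄G12) ∪ (G12⋄G2) ∪ (G2⋄G23) ∪ (G23⋄G3) ∪ (G3⋄G13) ∪ (G13⋄G1)
BlockAdj B1  B12 = ⊤
BlockAdj B12 B1  = ⊤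
BlockAdj B12 B2  = ⊤
BlockAdj B2  B12 = ⊤
BlockAdj B2  B23 = ⊤
BlockAdj B23 B2  = ⊤
BlockAdj B23 B3  = ⊤
BlockAdj B3  B23 = ⊤
BlockAdj B3  B13 = ⊤
BlockAdj B13 B3  = ⊤
BlockAdj B13 B1  = ⊤
BlockAdj B1  B13 = ⊤
-- ⋄ G123 : joined to each of the six other blocks
BlockAdj B123 B1   = ⊤
BlockAdj B123 B2   = ⊤
BlockAdj B123 B3   = ⊤
BlockAdj B123 B12  = ⊤
BlockAdj B123 B23  = ⊤
BlockAdj B123 B13  = ⊤
BlockAdj B1   B123 = ⊤
BlockAdj B2   B123 = ⊤
BlockAdj B3   B123 = ⊤
BlockAdj B12  B123 = ⊤
BlockAdj B23  B123 = ⊤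
BlockAdj B13  B123 = ⊤
-- ⋄ K₁ : joined to every other block
BlockAdj K  B1   = ⊤
BlockAdj K  B2   = ⊤
BlockAdj K  B3   = ⊤
BlockAdj K  B12  = ⊤
BlockAdj K  B23  = ⊤
BlockAdj K  B13  = ⊤
BlockAdj K  B123 = ⊤
BlockAdj B1   K  = ⊤
BlockAdj B2   K  = ⊤
BlockAdj B3   K  = ⊤
BlockAdj B12  K  = ⊤
BlockAdj B23  K  = ⊤
BlockAdj B13  K  = ⊤
BlockAdj B123 K  = ⊤
BlockAdj _ _ = ⊥

TVertex : ℕ → ℕ → ℕ → Set
TVertex p₁ p₂ p₃ = Σ Block (λ b → Fin (blockSize p₁ p₂ p₃ b))

TAdj : (p₁ p₂ p₃ : ℕ) → TVertex p₁ p₂ p₃ → TVertex p₁ p₂ p₃ → Set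
TAdj p₁ p₂ p₃ (b , _) (c , _) = BlockAdj b c

-- An element x of ℤ/p₁p₂p₃ℤ has order ∏ pᵢ^[pᵢ ∤ x], so its order is determined by its support
-- {i | pᵢ ∤ x}, and for squarefree orders divisibility is inclusion of supports. Two elements are
-- therefore adjacent in OD exactly when their supports are strictly nested. By the Chinese
-- remainder theorem x ↦ (x mod p₁, x mod p₂, x mod p₃) is a bijection, and the residue triples
-- with support S are counted by ∏_{i ∈ S} (pᵢ - 1); these are the eight blocks of the target graph,
-- whose edges join exactly the pairs of blocks with strictly nested supports.
module Submission where

open import Defs
open import Data.Nat using (ℕ; _*_)
open import Data.Nat.Primality using (Prime)
open import Data.Fin using (Fin)
open import Data.Product using (Σ)
open import Function.Bundles using (_↔_; _⇔_; Inverse)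
open import Relation.Binary.PropositionalEquality using (_≢_)

open import Data.Bool using (Bool; true; false; T; _∧_; _xor_)
open import Data.Bool.Properties using (T-∧; xor-same)
open import Data.Fin using (zero; suc; toℕ; combine; remQuot; punchOut)
open import Data.Fin.Properties
  using (toℕ-injective; toℕ-fromℕ<; toℕ<n; any?; punchOut-injective; injective⇒≤;
         combine-injective; combine-remQuot; remQuot-combine)
  renaming (_≟_ to _≟ᶠ_)
open import Data.Nat using (zero; suc; _∸_; _≤_; _<_; _+_; NonZero; >-nonZero⁻¹)
open import Data.Nat.Coprimality using (Coprime; coprime-divisor; coprime⇒gcd≡1; 1-coprimeTo)
import Data.Nat.Coprimality as Coprime
open import Data.Nat.Divisibility
open import Data.Nat.DivMod using (_%_; _/_; _mod_; m≡m%n+[m/n]*n)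
open import Data.Nat.GCD using (gcd)
open import Data.Nat.LCM using (lcm; lcm-least; gcd*lcm)
open import Data.Nat.Primality using (prime⇒irreducible; prime⇒nonZero; euclidsLemma; ¬prime[0]; ¬prime[1])
open import Data.Nat.Properties
open import Data.Product using (_×_; _,_; proj₁; proj₂; ∃; uncurry)
open import Data.Product.Function.NonDependent.Propositional using (_×-⇔_)
open import Data.Sum using (_⊎_; inj₁; inj₂)
open import Data.Unit using (tt)
open import Function using (id)
open import Data.Empty using (⊥-elim)
open import Function.Bundles using (mk⇔; mk↔ₛ′)
open import Function.Construct.Composition using (_↔-∘_; _⇔-∘_)
open import Function.Construct.Identity using (⇔-id)
open import Function.Construct.Symmetry using (⇔-sym)
open import Function.Definitions using (Injective)
open import Relation.Binary.Definitions using (tri<; tri≈; tri>)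
open import Relation.Binary.PropositionalEquality using (_≡_; refl; sym; trans; cong; cong₂; subst; subst₂; module ≡-Reasoning)
open import Relation.Nullary using (¬_; yes; no; contradiction)

open Function.Bundles.Equivalence using (to; from)

coprime-*ˡ : ∀ {a b c} → Coprime a c → Coprime b c → Coprime (a * b) c
coprime-*ˡ {a} a⊥c b⊥c {d} (d∣ab , d∣c) = b⊥c (coprime-divisor d⊥a d∣ab , d∣c)
  where
  d⊥a : Coprime d a
  d⊥a (e∣d , e∣a) = a⊥c (e∣a , ∣-trans e∣d d∣c)

coprime⇒*∣ : ∀ {a b y} → Coprime a b → a ∣ y → b ∣ y → a * b ∣ y
coprime⇒*∣ {a} {b} a⊥b a∣y b∣y = subst (_∣ _) lcm≡* (lcm-least a∣y b∣y)
  where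
  open ≡-Reasoning
  lcm≡* : lcm a b ≡ a * b
  lcm≡* = begin
    lcm a b           ≡⟨ sym (*-identityˡ (lcm a b)) ⟩
    1 * lcm a b       ≡⟨ cong (_* lcm a b) (coprime⇒gcd≡1 a⊥b) ⟨
    gcd a b * lcm a b ≡⟨ gcd*lcm a b ⟩
    a * b             ∎

primes-coprime : ∀ {p q} → Prime p → Prime q → p ≢ q → Coprime p q
primes-coprime P Q p≢q {d} (d∣p , d∣q) with prime⇒irreducible Q d∣q
... | inj₁ d≡1 = d≡1
... | inj₂ refl with prime⇒irreducible P d∣p
...   | inj₁ refl = contradiction Q ¬prime[1]
...   | inj₂ q≡p = contradiction (sym q≡p) p≢q

toℕ-mod : ∀ {d} .{{_ : NonZero d}} x → toℕ (x mod d) ≡ x % d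
toℕ-mod x = toℕ-fromℕ< _

mod≡mod⇒∣∸ : ∀ {d} .{{_ : NonZero d}} x y → x mod d ≡ y mod d → d ∣ y ∸ x
mod≡mod⇒∣∸ {d} x y eq = divides (y / d ∸ x / d) (begin
  y ∸ x                                     ≡⟨ cong₂ _∸_ (m≡m%n+[m/n]*n y d) (m≡m%n+[m/n]*n x d) ⟩
  (y % d + y / d * d) ∸ (x % d + x / d * d) ≡⟨ cong (λ r → (r + y / d * d) ∸ (x % d + x / d * d)) x%d≡y%d ⟨
  (x % d + y / d * d) ∸ (x % d + x / d * d) ≡⟨ [m+n]∸[m+o]≡n∸o (x % d) (y / d * d) (x / d * d) ⟩
  y / d * d ∸ x / d * d                     ≡⟨ *-distribʳ-∸ d (y / d) (x / d) ⟨
  (y / d ∸ x / d) * d                       ∎)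
  where
  open ≡-Reasoning
  x%d≡y%d : x % d ≡ y % d
  x%d≡y%d = trans (sym (toℕ-mod x)) (trans (cong toℕ eq) (toℕ-mod y))

∣∧<⇒≡0 : ∀ {n z} → n ∣ z → z < n → z ≡ 0
∣∧<⇒≡0 {z = zero}  _   _   = refl
∣∧<⇒≡0 {z = suc z} n∣z z<n = contradiction (∣⇒≤ n∣z) (<⇒≱ z<n)

injective⇒surjective : ∀ {n} (f : Fin n → Fin n) → Injective _≡_ _≡_ f → ∀ y → ∃ λ x → f x ≡ y
injective⇒surjective {suc n} f f-inj y with any? (λ x → f x ≟ᶠ y)
... | yes found = found
... | no missed = contradiction (injective⇒≤ g-inj) (<-irrefl refl)
  where
  y≢f : ∀ x → y ≢ f x
  y≢f x y≡fx = missed (x , sym y≡fx)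
  g : Fin (suc n) → Fin n
  g x = punchOut (y≢f x)
  g-inj : Injective _≡_ _≡_ g
  g-inj {x} {x′} gx≡gx′ = f-inj (punchOut-injective (y≢f x) (y≢f x′) gx≡gx′)

-- Finite Cantor–Schröder–Bernstein, keeping f itself as the forward map.
injections⇒↔ : ∀ {a} {A : Set a} {n} (f : Fin n → A) (g : A → Fin n) →
               Injective _≡_ _≡_ f → Injective _≡_ _≡_ g → Fin n ↔ A
injections⇒↔ {A = A} {n} f g f-inj g-inj = mk↔ₛ′ f f⁻¹
  (λ y → g-inj (proj₂ (g∘f-surj (g y))))
  (λ x → g∘f-inj (proj₂ (g∘f-surj (g (f x)))))
  where
  g∘f-inj : Injective _≡_ _≡_ (λ x → g (f x))
  g∘f-inj e = f-inj (g-inj e)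
  g∘f-surj : ∀ y → ∃ λ x → g (f x) ≡ y
  g∘f-surj = injective⇒surjective (λ x → g (f x)) g∘f-inj
  f⁻¹ : A → Fin n
  f⁻¹ y = proj₁ (g∘f-surj (g y))

IsOrder-unique : ∀ {n a k l} → IsOrder n a k → IsOrder n a l → k ≡ l
IsOrder-unique {k = k} {l} (1≤k , k-zero , k-least) (1≤l , l-zero , l-least) with <-cmp k l
... | tri< k<l _ _ = contradiction k-zero (l-least k 1≤k k<l)
... | tri≈ _ k≡l _ = k≡l
... | tri> _ _ l<k = contradiction l-zero (k-least l 1≤l l<k)

∣-annihilators⇒IsOrder : ∀ {n a k} → 1 ≤ k → MultIsZero n k a →
                         (∀ j → MultIsZero n j a → k ∣ j) → IsOrder n a k
∣-annihilators⇒IsOrder {n} {a} {k} 1≤k k-zero k∣ = 1≤k , k-zero , least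
  where
  least : ∀ j → 1 ≤ j → j < k → ¬ MultIsZero n j a
  least (suc j) _ j<k j-zero = <⇒≱ j<k (∣⇒≤ (k∣ (suc j) j-zero))

_^ᵇ_ : ℕ → Bool → ℕ
p ^ᵇ false = 1
p ^ᵇ true  = p

_⇒ᵇ_ : Bool → Bool → Bool
false ⇒ᵇ _ = true
true  ⇒ᵇ f = f

T-⇒ᵇ : ∀ {e f} → T (e ⇒ᵇ f) ⇔ (T e → T f)
T-⇒ᵇ {false}        = mk⇔ (λ _ ()) (λ _ → tt)
T-⇒ᵇ {true} {true}  = mk⇔ (λ _ _ → tt) (λ _ → tt)
T-⇒ᵇ {true} {false} = mk⇔ (λ ()) (λ h → h tt)

^ᵇ-positive : ∀ {p} .{{_ : NonZero p}} e → 1 ≤ p ^ᵇ e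
^ᵇ-positive     false = ≤-refl
^ᵇ-positive {p} true  = >-nonZero⁻¹ p

^ᵇ-mono-∣ : ∀ {p} e f → (T e → T f) → p ^ᵇ e ∣ p ^ᵇ f
^ᵇ-mono-∣ false f     _   = 1∣ _
^ᵇ-mono-∣ true  true  _   = ∣-refl
^ᵇ-mono-∣ true  false e⇒f = ⊥-elim (e⇒f tt)

p∣p^ᵇ : ∀ {p} e → T e → p ∣ p ^ᵇ e
p∣p^ᵇ true _ = ∣-refl

coprime-^ᵇ : ∀ {p q} → Coprime p q → ∀ e f → Coprime (p ^ᵇ e) (q ^ᵇ f)
coprime-^ᵇ p⊥q true  true  = p⊥q
coprime-^ᵇ p⊥q true  false = Coprime.sym (1-coprimeTo _)
coprime-^ᵇ p⊥q false f     = 1-coprimeTo _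

prime∣^ᵇ⇒ : ∀ {p q} → Prime p → Prime q → ∀ f → p ∣ q ^ᵇ f → p ≡ q × T f
prime∣^ᵇ⇒ P Q false p∣1 = contradiction (subst Prime (∣1⇒≡1 p∣1) P) ¬prime[1]
prime∣^ᵇ⇒ P Q true  p∣q with prime⇒irreducible Q p∣q
... | inj₁ refl = contradiction P ¬prime[1]
... | inj₂ p≡q  = p≡q , tt

nonzero : ∀ {n} → Fin n → Bool
nonzero zero    = false
nonzero (suc _) = true

-- p ^ᵇ nonzero (x mod p) is the order of x in ℤ/pℤ.
module _ {p} .{{_ : NonZero p}} where

  p∣p^ᵇ*x : ∀ x → p ∣ p ^ᵇ nonzero (x mod p) * x
  p∣p^ᵇ*x x with x mod p | toℕ-mod {p} x
  ... | zero  | 0≡x%p = subst (p ∣_) (sym (*-identityˡ x)) (m%n≡0⇒n∣m x p (sym 0≡x%p))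
  ... | suc _ | _     = m∣m*n x

  p∣j*x⇒p^ᵇ∣j : Prime p → ∀ x j → p ∣ j * x → p ^ᵇ nonzero (x mod p) ∣ j
  p∣j*x⇒p^ᵇ∣j P x j p∣jx with x mod p | toℕ-mod {p} x
  ... | zero  | _       = 1∣ j
  ... | suc _ | 1+r≡x%p with euclidsLemma j x P p∣jx
  ...   | inj₁ p∣j = p∣j
  ...   | inj₂ p∣x with trans 1+r≡x%p (n∣m⇒m%n≡0 x p p∣x)
  ...     | ()

-- The support {i | eᵢ} ⊆ {1, 2, 3} of a squarefree divisor ∏ pᵢ^eᵢ of p₁p₂p₃.
Support : Set
Support = Bool × Bool × Bool

_⊆ᵇ_ : Support → Support → Bool
(e₁ , e₂ , e₃) ⊆ᵇ (f₁ , f₂ , f₃) = (e₁ ⇒ᵇ f₁) ∧ (e₂ ⇒ᵇ f₂) ∧ (e₃ ⇒ᵇ f₃)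

T-⊆ᵇ : ∀ {e₁ e₂ e₃ f₁ f₂ f₃} →
       T ((e₁ , e₂ , e₃) ⊆ᵇ (f₁ , f₂ , f₃)) ⇔ ((T e₁ → T f₁) × (T e₂ → T f₂) × (T e₃ → T f₃))
T-⊆ᵇ = (T-⇒ᵇ ×-⇔ T-⇒ᵇ ×-⇔ T-⇒ᵇ) ⇔-∘ ((⇔-id _ ×-⇔ T-∧) ⇔-∘ T-∧)

strictlyNested : Support → Support → Bool
strictlyNested s t = (s ⊆ᵇ t) xor (t ⊆ᵇ s)

StrictlyComparable : ℕ → ℕ → Set
StrictlyComparable k l = k ≢ l × (k ∣ l ⊎ l ∣ k)

StrictlyComparable⇔xor : ∀ {k l} x y → (k ∣ l ⇔ T x) → (l ∣ k ⇔ T y) →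
                         StrictlyComparable k l ⇔ T (x xor y)
StrictlyComparable⇔xor true  true  k∣l l∣k =
  mk⇔ (λ (k≢l , _) → k≢l (∣-antisym (from k∣l tt) (from l∣k tt))) (λ ())
StrictlyComparable⇔xor true  false k∣l l∣k =
  mk⇔ (λ _ → tt) (λ _ → (λ k≡l → to l∣k (∣-reflexive (sym k≡l))) , inj₁ (from k∣l tt))
StrictlyComparable⇔xor false true  k∣l l∣k =
  mk⇔ (λ _ → tt) (λ _ → (λ k≡l → to k∣l (∣-reflexive k≡l)) , inj₂ (from l∣k tt))
StrictlyComparable⇔xor false false k∣l l∣k =
  mk⇔ (λ { (_ , inj₁ d) → to k∣l d ; (_ , inj₂ d) → to l∣k d }) (λ ())

support : Block → Support
support K    = false , false , false
support B1   = true  , false , false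
support B2   = false , true  , false
support B3   = false , false , true
support B12  = true  , true  , false
support B23  = false , true  , true
support B13  = true  , false , true
support B123 = true  , true  , true

BlockAdj⇔strictlyNested : ∀ b c → BlockAdj b c ⇔ T (strictlyNested (support b) (support c))
BlockAdj⇔strictlyNested B1   B1   = mk⇔ id id
BlockAdj⇔strictlyNested B1   B2   = mk⇔ id id
BlockAdj⇔strictlyNested B1   B3   = mk⇔ id id
BlockAdj⇔strictlyNested B1   B12  = mk⇔ id id
BlockAdj⇔strictlyNested B1   B23  = mk⇔ id id
BlockAdj⇔strictlyNested B1   B13  = mk⇔ id id
BlockAdj⇔strictlyNested B1   B123 = mk⇔ id id
BlockAdj⇔strictlyNested B1   K    = mk⇔ id id
BlockAdj⇔strictlyNested B2   B1   = mk⇔ id id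
BlockAdj⇔strictlyNested B2   B2   = mk⇔ id id
BlockAdj⇔strictlyNested B2   B3   = mk⇔ id id
BlockAdj⇔strictlyNested B2   B12  = mk⇔ id id
BlockAdj⇔strictlyNested B2   B23  = mk⇔ id id
BlockAdj⇔strictlyNested B2   B13  = mk⇔ id id
BlockAdj⇔strictlyNested B2   B123 = mk⇔ id id
BlockAdj⇔strictlyNested B2   K    = mk⇔ id id
BlockAdj⇔strictlyNested B3   B1   = mk⇔ id id
BlockAdj⇔strictlyNested B3   B2   = mk⇔ id id
BlockAdj⇔strictlyNested B3   B3   = mk⇔ id id
BlockAdj⇔strictlyNested B3   B12  = mk⇔ id id
BlockAdj⇔strictlyNested B3   B23  = mk⇔ id id
BlockAdj⇔strictlyNested B3   B13  = mk⇔ id id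
BlockAdj⇔strictlyNested B3   B123 = mk⇔ id id
BlockAdj⇔strictlyNested B3   K    = mk⇔ id id
BlockAdj⇔strictlyNested B12  B1   = mk⇔ id id
BlockAdj⇔strictlyNested B12  B2   = mk⇔ id id
BlockAdj⇔strictlyNested B12  B3   = mk⇔ id id
BlockAdj⇔strictlyNested B12  B12  = mk⇔ id id
BlockAdj⇔strictlyNested B12  B23  = mk⇔ id id
BlockAdj⇔strictlyNested B12  B13  = mk⇔ id id
BlockAdj⇔strictlyNested B12  B123 = mk⇔ id id
BlockAdj⇔strictlyNested B12  K    = mk⇔ id id
BlockAdj⇔strictlyNested B23  B1   = mk⇔ id id
BlockAdj⇔strictlyNested B23  B2   = mk⇔ id id
BlockAdj⇔strictlyNested B23  B3   = mk⇔ id id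
BlockAdj⇔strictlyNested B23  B12  = mk⇔ id id
BlockAdj⇔strictlyNested B23  B23  = mk⇔ id id
BlockAdj⇔strictlyNested B23  B13  = mk⇔ id id
BlockAdj⇔strictlyNested B23  B123 = mk⇔ id id
BlockAdj⇔strictlyNested B23  K    = mk⇔ id id
BlockAdj⇔strictlyNested B13  B1   = mk⇔ id id
BlockAdj⇔strictlyNested B13  B2   = mk⇔ id id
BlockAdj⇔strictlyNested B13  B3   = mk⇔ id id
BlockAdj⇔strictlyNested B13  B12  = mk⇔ id id
BlockAdj⇔strictlyNested B13  B23  = mk⇔ id id
BlockAdj⇔strictlyNested B13  B13  = mk⇔ id id
BlockAdj⇔strictlyNested B13  B123 = mk⇔ id id
BlockAdj⇔strictlyNested B13  K    = mk⇔ id id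
BlockAdj⇔strictlyNested B123 B1   = mk⇔ id id
BlockAdj⇔strictlyNested B123 B2   = mk⇔ id id
BlockAdj⇔strictlyNested B123 B3   = mk⇔ id id
BlockAdj⇔strictlyNested B123 B12  = mk⇔ id id
BlockAdj⇔strictlyNested B123 B23  = mk⇔ id id
BlockAdj⇔strictlyNested B123 B13  = mk⇔ id id
BlockAdj⇔strictlyNested B123 B123 = mk⇔ id id
BlockAdj⇔strictlyNested B123 K    = mk⇔ id id
BlockAdj⇔strictlyNested K    B1   = mk⇔ id id
BlockAdj⇔strictlyNested K    B2   = mk⇔ id id
BlockAdj⇔strictlyNested K    B3   = mk⇔ id id
BlockAdj⇔strictlyNested K    B12  = mk⇔ id id
BlockAdj⇔strictlyNested K    B23  = mk⇔ id id
BlockAdj⇔strictlyNested K    B13  = mk⇔ id id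
BlockAdj⇔strictlyNested K    B123 = mk⇔ id id
BlockAdj⇔strictlyNested K    K    = mk⇔ id id

residueSupport : ∀ {n₁ n₂ n₃} → Fin n₁ × Fin n₂ × Fin n₃ → Support
residueSupport (r₁ , r₂ , r₃) = nonzero r₁ , nonzero r₂ , nonzero r₃

module _ {k₁ k₂ k₃ : ℕ} where

  vertex : Fin (suc k₁) × Fin (suc k₂) × Fin (suc k₃) → TVertex (suc k₁) (suc k₂) (suc k₃)
  vertex (zero  , zero  , zero ) = K    , zero
  vertex (suc i , zero  , zero ) = B1   , i
  vertex (zero  , suc j , zero ) = B2   , j
  vertex (zero  , zero  , suc l) = B3   , l
  vertex (suc i , suc j , zero ) = B12  , combine i j
  vertex (zero  , suc j , suc l) = B23  , combine j l
  vertex (suc i , zero  , suc l) = B13  , combine i l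
  vertex (suc i , suc j , suc l) = B123 , combine (combine i j) l

  unvertex : TVertex (suc k₁) (suc k₂) (suc k₃) → Fin (suc k₁) × Fin (suc k₂) × Fin (suc k₃)
  unvertex (K    , _) = zero , zero , zero
  unvertex (B1   , i) = suc i , zero , zero
  unvertex (B2   , j) = zero , suc j , zero
  unvertex (B3   , l) = zero , zero , suc l
  unvertex (B12  , v) = let (i , j) = remQuot k₂ v in suc i , suc j , zero
  unvertex (B23  , v) = let (j , l) = remQuot k₃ v in zero , suc j , suc l
  unvertex (B13  , v) = let (i , l) = remQuot k₃ v in suc i , zero , suc l
  unvertex (B123 , v) = let (ij , l) = remQuot k₃ v ; (i , j) = remQuot k₂ ij in suc i , suc j , suc l

  vertex-unvertex : ∀ v → vertex (unvertex v) ≡ v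
  vertex-unvertex (K    , zero) = refl
  vertex-unvertex (B1   , _) = refl
  vertex-unvertex (B2   , _) = refl
  vertex-unvertex (B3   , _) = refl
  vertex-unvertex (B12  , v) = cong (B12 ,_) (combine-remQuot {k₁} k₂ v)
  vertex-unvertex (B23  , v) = cong (B23 ,_) (combine-remQuot {k₂} k₃ v)
  vertex-unvertex (B13  , v) = cong (B13 ,_) (combine-remQuot {k₁} k₃ v)
  vertex-unvertex (B123 , v) = cong (B123 ,_) (begin
    combine (uncurry combine (remQuot {k₁} k₂ ij)) l ≡⟨ cong (λ w → combine w l) (combine-remQuot {k₁} k₂ ij) ⟩
    combine ij l                                     ≡⟨ combine-remQuot {k₁ * k₂} k₃ v ⟩
    v                                                ∎)
    where
    open ≡-Reasoning
    ij : Fin (k₁ * k₂)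
    ij = proj₁ (remQuot {k₁ * k₂} k₃ v)
    l : Fin k₃
    l  = proj₂ (remQuot {k₁ * k₂} k₃ v)

  unvertex-vertex : ∀ r → unvertex (vertex r) ≡ r
  unvertex-vertex (zero  , zero  , zero ) = refl
  unvertex-vertex (suc i , zero  , zero ) = refl
  unvertex-vertex (zero  , suc j , zero ) = refl
  unvertex-vertex (zero  , zero  , suc l) = refl
  unvertex-vertex (suc i , suc j , zero ) = cong (λ (i′ , j′) → suc i′ , suc j′ , zero) (remQuot-combine i j)
  unvertex-vertex (zero  , suc j , suc l) = cong (λ (j′ , l′) → zero , suc j′ , suc l′) (remQuot-combine j l)
  unvertex-vertex (suc i , zero  , suc l) = cong (λ (i′ , l′) → suc i′ , zero , suc l′) (remQuot-combine i l)
  unvertex-vertex (suc i , suc j , suc l) = trans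
    (cong (λ (ij , l′) → let (i′ , j′) = remQuot k₂ ij in suc i′ , suc j′ , suc l′)
          (remQuot-combine (combine i j) l))
    (cong (λ (i′ , j′) → suc i′ , suc j′ , suc l) (remQuot-combine i j))

  vertex↔ : (Fin (suc k₁) × Fin (suc k₂) × Fin (suc k₃)) ↔ TVertex (suc k₁) (suc k₂) (suc k₃)
  vertex↔ = mk↔ₛ′ vertex unvertex vertex-unvertex unvertex-vertex

  support-vertex : ∀ r → support (proj₁ (vertex r)) ≡ residueSupport r
  support-vertex (zero  , zero  , zero ) = refl
  support-vertex (suc _ , zero  , zero ) = refl
  support-vertex (zero  , suc _ , zero ) = refl
  support-vertex (zero  , zero  , suc _) = refl
  support-vertex (suc _ , suc _ , zero ) = refl
  support-vertex (zero  , suc _ , suc _) = refl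
  support-vertex (suc _ , zero  , suc _) = refl
  support-vertex (suc _ , suc _ , suc _) = refl

  TAdj-vertex⇔strictlyNested : ∀ r r′ →
    TAdj (suc k₁) (suc k₂) (suc k₃) (vertex r) (vertex r′) ⇔ T (strictlyNested (residueSupport r) (residueSupport r′))
  TAdj-vertex⇔strictlyNested r r′ =
    subst₂ (λ s t → TAdj _ _ _ (vertex r) (vertex r′) ⇔ T (strictlyNested s t))
      (support-vertex r) (support-vertex r′) (BlockAdj⇔strictlyNested _ _)

module CyclicOfOrderThreePrimes {p₁ p₂ p₃ : ℕ} (P₁ : Prime p₁) (P₂ : Prime p₂) (P₃ : Prime p₃)
  (p₁≢p₂ : p₁ ≢ p₂) (p₂≢p₃ : p₂ ≢ p₃) (p₁≢p₃ : p₁ ≢ p₃) where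

  instance
    p₁-nonZero : NonZero p₁
    p₁-nonZero = prime⇒nonZero P₁
    p₂-nonZero : NonZero p₂
    p₂-nonZero = prime⇒nonZero P₂
    p₃-nonZero : NonZero p₃
    p₃-nonZero = prime⇒nonZero P₃

  n : ℕ
  n = p₁ * p₂ * p₃

  -- order (true , true , true) reduces to n, so order-∣ also proves n ∣ y.
  order : Support → ℕ
  order (e₁ , e₂ , e₃) = p₁ ^ᵇ e₁ * p₂ ^ᵇ e₂ * p₃ ^ᵇ e₃

  ^ᵇ₁∣order : ∀ e₁ e₂ e₃ → p₁ ^ᵇ e₁ ∣ order (e₁ , e₂ , e₃)
  ^ᵇ₁∣order _ _ e₃ = ∣m⇒∣m*n (p₃ ^ᵇ e₃) (m∣m*n _)

  ^ᵇ₂∣order : ∀ e₁ e₂ e₃ → p₂ ^ᵇ e₂ ∣ order (e₁ , e₂ , e₃)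
  ^ᵇ₂∣order e₁ _ e₃ = n∣m*n*o (p₁ ^ᵇ e₁) (p₃ ^ᵇ e₃)

  ^ᵇ₃∣order : ∀ e₁ e₂ e₃ → p₃ ^ᵇ e₃ ∣ order (e₁ , e₂ , e₃)
  ^ᵇ₃∣order e₁ e₂ _ = n∣m*n (p₁ ^ᵇ e₁ * p₂ ^ᵇ e₂)

  order-∣ : ∀ e₁ e₂ e₃ {y} → p₁ ^ᵇ e₁ ∣ y → p₂ ^ᵇ e₂ ∣ y → p₃ ^ᵇ e₃ ∣ y → order (e₁ , e₂ , e₃) ∣ y
  order-∣ e₁ e₂ e₃ d₁ d₂ d₃ =
    coprime⇒*∣ (coprime-*ˡ (coprime-^ᵇ p₁⊥p₃ e₁ e₃) (coprime-^ᵇ p₂⊥p₃ e₂ e₃))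
      (coprime⇒*∣ (coprime-^ᵇ p₁⊥p₂ e₁ e₂) d₁ d₂) d₃
    where
    p₁⊥p₂ : Coprime p₁ p₂
    p₁⊥p₂ = primes-coprime P₁ P₂ p₁≢p₂
    p₂⊥p₃ : Coprime p₂ p₃
    p₂⊥p₃ = primes-coprime P₂ P₃ p₂≢p₃
    p₁⊥p₃ : Coprime p₁ p₃
    p₁⊥p₃ = primes-coprime P₁ P₃ p₁≢p₃

  prime∣order⇒ : ∀ {p} → Prime p → ∀ f₁ f₂ f₃ → p ∣ order (f₁ , f₂ , f₃) →
                 (p ≡ p₁ × T f₁) ⊎ (p ≡ p₂ × T f₂) ⊎ (p ≡ p₃ × T f₃)
  prime∣order⇒ P f₁ f₂ f₃ p∣order with euclidsLemma _ _ P p∣order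
  ... | inj₂ p∣₃ = inj₂ (inj₂ (prime∣^ᵇ⇒ P P₃ f₃ p∣₃))
  ... | inj₁ p∣₁₂ with euclidsLemma _ _ P p∣₁₂
  ...   | inj₁ p∣₁ = inj₁ (prime∣^ᵇ⇒ P P₁ f₁ p∣₁)
  ...   | inj₂ p∣₂ = inj₂ (inj₁ (prime∣^ᵇ⇒ P P₂ f₂ p∣₂))

  p₁∣order⇒ : ∀ f₁ f₂ f₃ → p₁ ∣ order (f₁ , f₂ , f₃) → T f₁
  p₁∣order⇒ f₁ f₂ f₃ p₁∣order with prime∣order⇒ P₁ f₁ f₂ f₃ p₁∣order
  ... | inj₁ (_ , f₁-holds)       = f₁-holds
  ... | inj₂ (inj₁ (p₁≡p₂ , _))  = contradiction p₁≡p₂ p₁≢p₂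
  ... | inj₂ (inj₂ (p₁≡p₃ , _))  = contradiction p₁≡p₃ p₁≢p₃

  p₂∣order⇒ : ∀ f₁ f₂ f₃ → p₂ ∣ order (f₁ , f₂ , f₃) → T f₂
  p₂∣order⇒ f₁ f₂ f₃ p₂∣order with prime∣order⇒ P₂ f₁ f₂ f₃ p₂∣order
  ... | inj₁ (p₂≡p₁ , _)          = contradiction (sym p₂≡p₁) p₁≢p₂
  ... | inj₂ (inj₁ (_ , f₂-holds)) = f₂-holds
  ... | inj₂ (inj₂ (p₂≡p₃ , _))  = contradiction p₂≡p₃ p₂≢p₃

  p₃∣order⇒ : ∀ f₁ f₂ f₃ → p₃ ∣ order (f₁ , f₂ , f₃) → T f₃
  p₃∣order⇒ f₁ f₂ f₃ p₃∣order with prime∣order⇒ P₃ f₁ f₂ f₃ p₃∣order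
  ... | inj₁ (p₃≡p₁ , _)          = contradiction (sym p₃≡p₁) p₁≢p₃
  ... | inj₂ (inj₁ (p₃≡p₂ , _))  = contradiction (sym p₃≡p₂) p₂≢p₃
  ... | inj₂ (inj₂ (_ , f₃-holds)) = f₃-holds

  order-∣⇔⊆ᵇ : ∀ s t → order s ∣ order t ⇔ T (s ⊆ᵇ t)
  order-∣⇔⊆ᵇ (e₁ , e₂ , e₃) (f₁ , f₂ , f₃) = mk⇔
    (λ d → from T-⊆ᵇ
      ( (λ e₁-holds → p₁∣order⇒ f₁ f₂ f₃ (∣-trans (∣-trans (p∣p^ᵇ e₁ e₁-holds) (^ᵇ₁∣order e₁ e₂ e₃)) d))
      , (λ e₂-holds → p₂∣order⇒ f₁ f₂ f₃ (∣-trans (∣-trans (p∣p^ᵇ e₂ e₂-holds) (^ᵇ₂∣order e₁ e₂ e₃)) d))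
      , (λ e₃-holds → p₃∣order⇒ f₁ f₂ f₃ (∣-trans (∣-trans (p∣p^ᵇ e₃ e₃-holds) (^ᵇ₃∣order e₁ e₂ e₃)) d))))
    (λ s⊆t → let (e₁⇒f₁ , e₂⇒f₂ , e₃⇒f₃) = to T-⊆ᵇ s⊆t in
      *-pres-∣ (*-pres-∣ (^ᵇ-mono-∣ e₁ f₁ e₁⇒f₁) (^ᵇ-mono-∣ e₂ f₂ e₂⇒f₂)) (^ᵇ-mono-∣ e₃ f₃ e₃⇒f₃))

  residues : Fin n → Fin p₁ × Fin p₂ × Fin p₃
  residues a = toℕ a mod p₁ , toℕ a mod p₂ , toℕ a mod p₃

  supportOf : Fin n → Support
  supportOf a = residueSupport (residues a)

  IsOrder-supportOf : ∀ a → IsOrder n a (order (supportOf a))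
  IsOrder-supportOf a = ∣-annihilators⇒IsOrder positive annihilates divides-annihilators
    where
    x : ℕ
    x  = toℕ a
    e₁ e₂ e₃ : Bool
    e₁ = nonzero (x mod p₁)
    e₂ = nonzero (x mod p₂)
    e₃ = nonzero (x mod p₃)
    positive : 1 ≤ order (e₁ , e₂ , e₃)
    positive = *-mono-≤ (*-mono-≤ (^ᵇ-positive e₁) (^ᵇ-positive e₂)) (^ᵇ-positive e₃)
    annihilates : n ∣ order (e₁ , e₂ , e₃) * x
    annihilates = order-∣ true true true
      (∣-trans (p∣p^ᵇ*x x) (*-monoˡ-∣ x (^ᵇ₁∣order e₁ e₂ e₃)))
      (∣-trans (p∣p^ᵇ*x x) (*-monoˡ-∣ x (^ᵇ₂∣order e₁ e₂ e₃)))
      (∣-trans (p∣p^ᵇ*x x) (*-monoˡ-∣ x (^ᵇ₃∣order e₁ e₂ e₃)))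
    divides-annihilators : ∀ j → n ∣ j * x → order (e₁ , e₂ , e₃) ∣ j
    divides-annihilators j n∣jx = order-∣ e₁ e₂ e₃
      (p∣j*x⇒p^ᵇ∣j P₁ x j (∣-trans (^ᵇ₁∣order true true true) n∣jx))
      (p∣j*x⇒p^ᵇ∣j P₂ x j (∣-trans (^ᵇ₂∣order true true true) n∣jx))
      (p∣j*x⇒p^ᵇ∣j P₃ x j (∣-trans (^ᵇ₃∣order true true true) n∣jx))

  residues-≡⇒≤ : ∀ {a b} → residues a ≡ residues b → toℕ b ≤ toℕ a
  residues-≡⇒≤ {a} {b} eq = m∸n≡0⇒m≤n (∣∧<⇒≡0 n∣y∸x (≤-<-trans (m∸n≤m y x) (toℕ<n b)))
    where
    x y : ℕ
    x = toℕ a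
    y = toℕ b
    n∣y∸x : n ∣ y ∸ x
    n∣y∸x = order-∣ true true true
      (mod≡mod⇒∣∸ x y (cong proj₁ eq))
      (mod≡mod⇒∣∸ x y (cong (λ r → proj₁ (proj₂ r)) eq))
      (mod≡mod⇒∣∸ x y (cong (λ r → proj₂ (proj₂ r)) eq))

  residues-injective : Injective _≡_ _≡_ residues
  residues-injective eq = toℕ-injective (≤-antisym (residues-≡⇒≤ (sym eq)) (residues-≡⇒≤ eq))

  encode : Fin p₁ × Fin p₂ × Fin p₃ → Fin n
  encode (r₁ , r₂ , r₃) = combine (combine r₁ r₂) r₃

  encode-injective : Injective _≡_ _≡_ encode
  encode-injective {r₁ , r₂ , r₃} {s₁ , s₂ , s₃} eq
    with r₁₂≡s₁₂ , refl ← combine-injective (combine r₁ r₂) r₃ (combine s₁ s₂) s₃ eq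
    with refl , refl ← combine-injective r₁ r₂ s₁ s₂ r₁₂≡s₁₂ = refl

  -- The Chinese remainder theorem; surjectivity comes from counting.
  residues↔ : Fin n ↔ (Fin p₁ × Fin p₂ × Fin p₃)
  residues↔ = injections⇒↔ residues encode residues-injective encode-injective

  ODAdj⇔strictlyNested : ∀ a b → ODAdj n a b ⇔ T (strictlyNested (supportOf a) (supportOf b))
  ODAdj⇔strictlyNested a b = mk⇔
    (λ (_ , k , l , k-order , l-order , k≍l) → to orders⇔ (subst₂ StrictlyComparable
      (IsOrder-unique k-order (IsOrder-supportOf a)) (IsOrder-unique l-order (IsOrder-supportOf b)) k≍l))
    (λ nested → (λ { refl → subst T (xor-same (s ⊆ᵇ s)) nested })
      , _ , _ , IsOrder-supportOf a , IsOrder-supportOf b , from orders⇔ nested)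
    where
    s t : Support
    s = supportOf a
    t = supportOf b
    orders⇔ : StrictlyComparable (order s) (order t) ⇔ T (strictlyNested s t)
    orders⇔ = StrictlyComparable⇔xor (s ⊆ᵇ t) (t ⊆ᵇ s) (order-∣⇔⊆ᵇ s t) (order-∣⇔⊆ᵇ t s)

theorem5 : (p₁ p₂ p₃ : ℕ) → Prime p₁ → Prime p₂ → Prime p₃ →
           p₁ ≢ p₂ → p₂ ≢ p₃ → p₁ ≢ p₃ →
           Σ (Fin (p₁ * p₂ * p₃) ↔ TVertex p₁ p₂ p₃) (λ f →
             (a b : Fin (p₁ * p₂ * p₃)) →
               ODAdj (p₁ * p₂ * p₃) a b ⇔ TAdj p₁ p₂ p₃ (Inverse.to f a) (Inverse.to f b))
theorem5 zero    _       _       P₁ _  _  _ _ _ = contradiction P₁ ¬prime[0]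
theorem5 (suc _) zero    _       _  P₂ _  _ _ _ = contradiction P₂ ¬prime[0]
theorem5 (suc _) (suc _) zero    _  _  P₃ _ _ _ = contradiction P₃ ¬prime[0]
theorem5 (suc _) (suc _) (suc _) P₁ P₂ P₃ p₁≢p₂ p₂≢p₃ p₁≢p₃ =
  vertex↔ ↔-∘ residues↔ ,
  λ a b → ⇔-sym (TAdj-vertex⇔strictlyNested (residues a) (residues b)) ⇔-∘ ODAdj⇔strictlyNested a b
  where open CyclicOfOrderThreePrimes P₁ P₂ P₃ p₁≢p₂ p₂≢p₃ p₁≢p₃
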